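{- Let $\alpha,\beta,\gamma$ be real numbers with $\gamma\neq\alpha$, and let $A,B,C,D,E,F,X$ be nonzero real numbers. Define $$a=(\beta-\alpha)\frac{BF}{AX},\qquad b=(\gamma-\alpha)\frac{CX}{BD},\qquad c=(\gamma-\beta)\frac{DF}{EX}.$$ Suppose $(\beta-\alpha)BE+(\gamma-\beta)AD\neq 0$ and define $X'$ by $(\gamma-\alpha)XX'=(\beta-\alpha)BE+(\gamma-\beta)AD$, and $$d=(\gamma-\beta)\frac{AC}{BX'},\qquad e=(\gamma-\alpha)\frac{FX'}{AE},\qquad f=(\beta-\alpha)\frac{CE}{DX'}.$$ Then $a+c\neq 0$ and $$d=\frac{bc}{a+c},\qquad e=a+c,\qquad f=\frac{ab}{a+c}.$$
   Context: Interpretation (for orientation only): three wires carrying parameters $\alpha,\beta,\gamma$ form a triangle in a wiring diagram, with crossing (vertex) parameters $a,b,c$ read left to right for a word $s_is_js_i$; the chambers around the triangle are $A$ (left), $B$ (upper left), $C$ (top), $D$ (upper right), $E$ (right), $F$ (bottom), and $X$ is the central chamber. A crossing parameter equals the difference of the wire parameters times (product of the chamber variables above and below the crossing)/(product of the chamber variables to its left and right). The enriched Yang–Baxter move replaces $X$ by $X'$ and produces the word $s_js_is_j$ with crossing parameters $d,e,f$ computed by the same rule; the claim says these agree with Lusztig's braid relation $s_i(a)s_j(b)s_i(c)=s_j\!\left(\tfrac{bc}{a+c}\right)s_i(a+c)s_j\!\left(\tfrac{ab}{a+c}\right)$. -}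

module Defs where

open import Level using (_⊔_; suc)
open import Algebra.Bundles using (CommutativeRing)
open import Relation.Nullary using (¬_)

-- The inverse is a total operation (its value
-- at 0 is unspecified), compatible with the setoid equality.
record Field (c ℓ : Level.Level) : Set (suc (c ⊔ ℓ)) where
  field
    commutativeRing : CommutativeRing c ℓ
  open CommutativeRing commutativeRing public
  field
    _⁻¹       : Carrier → Carrier
    ⁻¹-cong   : ∀ {x y} → x ≈ y → (x ⁻¹) ≈ (y ⁻¹)
    1≉0       : ¬ (1# ≈ 0#)
    inverseʳ  : ∀ x → ¬ (x ≈ 0#) → (x * (x ⁻¹)) ≈ 1#

  infixl 7 _/_
  _/_ : Carrier → Carrier → Carrier
  x / y = x * (y ⁻¹)

  infixl 6 _−_
  _−_ : Carrier → Carrier → Carrier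
  x − y = x + (- y)

module Submission where

open import Defs
open import Data.Product using (_×_; _,_)
open import Relation.Nullary using (¬_)
import Relation.Binary.Reasoning.Setoid as SetoidReasoning

-- The identities e = a + c, d e = b c and f e = a b are proved by clearing
-- denominators: the last two then become polynomial identities, and the first
-- becomes the defining relation of X′ multiplied by F A E X.  Dividing by
-- e ≠ 0 gives d and f.

module FieldProperties {k ℓ} (K : Field k ℓ) where

  open Field K
  open SetoidReasoning setoid
  open import Algebra.Solver.Ring.NaturalCoefficients.Default commutativeSemiring
    using (solve; _:=_; _:*_; _:+_)

  *-cancel-inverseʳ : ∀ {y} → ¬ (y ≈ 0#) → ∀ x → x * y * y ⁻¹ ≈ x
  *-cancel-inverseʳ {y} y≉0 x = begin
    x * y * y ⁻¹    ≈⟨ *-assoc x y (y ⁻¹) ⟩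
    x * (y * y ⁻¹)  ≈⟨ *-congˡ (inverseʳ y y≉0) ⟩
    x * 1#          ≈⟨ *-identityʳ x ⟩
    x               ∎

  x*y≉0 : ∀ {x y} → ¬ (x ≈ 0#) → ¬ (y ≈ 0#) → ¬ (x * y ≈ 0#)
  x*y≉0 {x} {y} x≉0 y≉0 xy≈0 = x≉0 (begin
    x             ≈⟨ sym (*-cancel-inverseʳ y≉0 x) ⟩
    x * y * y ⁻¹  ≈⟨ *-congʳ xy≈0 ⟩
    0# * y ⁻¹     ≈⟨ zeroˡ (y ⁻¹) ⟩
    0#            ∎)

  x⁻¹≉0 : ∀ {x} → ¬ (x ≈ 0#) → ¬ (x ⁻¹ ≈ 0#)
  x⁻¹≉0 {x} x≉0 x⁻¹≈0 = 1≉0 (begin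
    1#        ≈⟨ sym (inverseʳ x x≉0) ⟩
    x * x ⁻¹  ≈⟨ *-congˡ x⁻¹≈0 ⟩
    x * 0#    ≈⟨ zeroʳ x ⟩
    0#        ∎)

  x/y≉0 : ∀ {x y} → ¬ (x ≈ 0#) → ¬ (y ≈ 0#) → ¬ (x / y ≈ 0#)
  x/y≉0 x≉0 y≉0 = x*y≉0 x≉0 (x⁻¹≉0 y≉0)

  x−y≉0 : ∀ {x y} → ¬ (x ≈ y) → ¬ (x − y ≈ 0#)
  x−y≉0 {x} {y} x≉y x−y≈0 = x≉y (begin
    x              ≈⟨ sym (+-identityʳ x) ⟩
    x + 0#         ≈⟨ +-congˡ (sym (-‿inverseˡ y)) ⟩
    x + (- y + y)  ≈⟨ sym (+-assoc x (- y) y) ⟩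
    x − y + y      ≈⟨ +-congʳ x−y≈0 ⟩
    0# + y         ≈⟨ +-identityˡ y ⟩
    y              ∎)

  ⁻¹-unique : ∀ {x y} → ¬ (x ≈ 0#) → x * y ≈ 1# → y ≈ x ⁻¹
  ⁻¹-unique {x} {y} x≉0 xy≈1 = begin
    y                ≈⟨ sym (*-cancel-inverseʳ x≉0 y) ⟩
    y * x * x ⁻¹     ≈⟨ *-congʳ (*-comm y x) ⟩
    x * y * x ⁻¹     ≈⟨ *-congʳ xy≈1 ⟩
    1# * x ⁻¹        ≈⟨ *-identityˡ (x ⁻¹) ⟩
    x ⁻¹             ∎

  ⁻¹-distrib-* : ∀ {x y} → ¬ (x ≈ 0#) → ¬ (y ≈ 0#) → (x * y) ⁻¹ ≈ x ⁻¹ * y ⁻¹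
  ⁻¹-distrib-* {x} {y} x≉0 y≉0 = sym (⁻¹-unique (x*y≉0 x≉0 y≉0) (begin
    x * y * (x ⁻¹ * y ⁻¹)      ≈⟨ solve 4 (λ x y x′ y′ → x :* y :* (x′ :* y′) := x :* x′ :* (y :* y′))
                                    refl x y (x ⁻¹) (y ⁻¹) ⟩
    x * x ⁻¹ * (y * y ⁻¹)      ≈⟨ *-cong (inverseʳ x x≉0) (inverseʳ y y≉0) ⟩
    1# * 1#                    ≈⟨ *-identityˡ 1# ⟩
    1#                         ∎))

  x*[y/z]≈[x*y]/z : ∀ x y z → x * (y / z) ≈ (x * y) / z
  x*[y/z]≈[x*y]/z x y z = sym (*-assoc x y (z ⁻¹))

  /-*-/ : ∀ {y v} → ¬ (y ≈ 0#) → ¬ (v ≈ 0#) → ∀ x u → (x / y) * (u / v) ≈ (x * u) / (y * v)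
  /-*-/ {y} {v} y≉0 v≉0 x u = begin
    x * y ⁻¹ * (u * v ⁻¹)   ≈⟨ solve 4 (λ x u y′ v′ → x :* y′ :* (u :* v′) := x :* u :* (y′ :* v′))
                                 refl x u (y ⁻¹) (v ⁻¹) ⟩
    x * u * (y ⁻¹ * v ⁻¹)   ≈⟨ *-congˡ (sym (⁻¹-distrib-* y≉0 v≉0)) ⟩
    x * u * (y * v) ⁻¹      ∎

  /-+-/ : ∀ {y v} → ¬ (y ≈ 0#) → ¬ (v ≈ 0#) → ∀ x u → x / y + u / v ≈ (x * v + u * y) / (y * v)
  /-+-/ {y} {v} y≉0 v≉0 x u = begin
    x * y ⁻¹ + u * v ⁻¹
      ≈⟨ +-cong (sym (*-cancel-inverseʳ v≉0 _)) (sym (*-cancel-inverseʳ y≉0 _)) ⟩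
    x * y ⁻¹ * v * v ⁻¹ + u * v ⁻¹ * y * y ⁻¹
      ≈⟨ solve 6 (λ x u y v y′ v′ →
             x :* y′ :* v :* v′ :+ u :* v′ :* y :* y′ := (x :* v :+ u :* y) :* (y′ :* v′))
           refl x u y v (y ⁻¹) (v ⁻¹) ⟩
    (x * v + u * y) * (y ⁻¹ * v ⁻¹)
      ≈⟨ *-congˡ (sym (⁻¹-distrib-* y≉0 v≉0)) ⟩
    (x * v + u * y) * (y * v) ⁻¹
      ∎

  /-cross : ∀ {y v} → ¬ (y ≈ 0#) → ¬ (v ≈ 0#) → ∀ {x u} → x * v ≈ u * y → x / y ≈ u / v
  /-cross {y} {v} y≉0 v≉0 {x} {u} xv≈uy = begin
    x * y ⁻¹                ≈⟨ sym (*-cancel-inverseʳ v≉0 _) ⟩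
    x * y ⁻¹ * v * v ⁻¹     ≈⟨ *-congʳ (solve 3 (λ x y′ v → x :* y′ :* v := x :* v :* y′) refl x (y ⁻¹) v) ⟩
    x * v * y ⁻¹ * v ⁻¹     ≈⟨ *-congʳ (*-congʳ xv≈uy) ⟩
    u * y * y ⁻¹ * v ⁻¹     ≈⟨ *-congʳ (*-cancel-inverseʳ y≉0 u) ⟩
    u * v ⁻¹                ∎

  scaled-/-*-/ : ∀ {y v} → ¬ (y ≈ 0#) → ¬ (v ≈ 0#) → ∀ s x t u →
                 s * (x / y) * (t * (u / v)) ≈ (s * x * (t * u)) / (y * v)
  scaled-/-*-/ {y} {v} y≉0 v≉0 s x t u =
    trans (*-cong (x*[y/z]≈[x*y]/z s x y) (x*[y/z]≈[x*y]/z t u v)) (/-*-/ y≉0 v≉0 (s * x) (t * u))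

  scaled-/-+-/ : ∀ {y v} → ¬ (y ≈ 0#) → ¬ (v ≈ 0#) → ∀ s x t u →
                 s * (x / y) + t * (u / v) ≈ (s * x * v + t * u * y) / (y * v)
  scaled-/-+-/ {y} {v} y≉0 v≉0 s x t u =
    trans (+-cong (x*[y/z]≈[x*y]/z s x y) (x*[y/z]≈[x*y]/z t u v)) (/-+-/ y≉0 v≉0 (s * x) (t * u))

  *-≈⇒≈-/ : ∀ {x y z} → ¬ (y ≈ 0#) → x * y ≈ z → x ≈ z / y
  *-≈⇒≈-/ {x} {y} y≉0 xy≈z = trans (sym (*-cancel-inverseʳ y≉0 x)) (*-congʳ xy≈z)

-- p, q, r play the role of the wire differences β − α, γ − β, γ − α; the
-- identities below hold for arbitrary scalars.
module BraidMove {k ℓ} (K : Field k ℓ) (p q r A B C D E F X X′ : Field.Carrier K) where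

  open Field K
  open FieldProperties K
  open SetoidReasoning setoid
  open import Algebra.Solver.Ring.NaturalCoefficients.Default commutativeSemiring
    using (solve; _:=_; _:*_; _:+_)

  a b c d e f : Carrier
  a = p * ((B * F) / (A * X))
  b = r * ((C * X) / (B * D))
  c = q * ((D * F) / (E * X))
  d = q * ((A * C) / (B * X′))
  e = r * ((F * X′) / (A * E))
  f = p * ((C * E) / (D * X′))

  e≈a+c : ¬ (A ≈ 0#) → ¬ (E ≈ 0#) → ¬ (X ≈ 0#) →
          r * X * X′ ≈ p * B * E + q * A * D → e ≈ a + c
  e≈a+c A≉0 E≉0 X≉0 X′-def = sym (begin
    a + c
      ≈⟨ scaled-/-+-/ (x*y≉0 A≉0 X≉0) (x*y≉0 E≉0 X≉0) p (B * F) q (D * F) ⟩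
    (p * (B * F) * (E * X) + q * (D * F) * (A * X)) / (A * X * (E * X))
      ≈⟨ /-cross (x*y≉0 (x*y≉0 A≉0 X≉0) (x*y≉0 E≉0 X≉0)) (x*y≉0 A≉0 E≉0) (begin
           (p * (B * F) * (E * X) + q * (D * F) * (A * X)) * (A * E)
             ≈⟨ solve 8 (λ p q A B D E F X →
                  (p :* (B :* F) :* (E :* X) :+ q :* (D :* F) :* (A :* X)) :* (A :* E)
                  := (p :* B :* E :+ q :* A :* D) :* (F :* A :* E :* X))
                refl p q A B D E F X ⟩
           (p * B * E + q * A * D) * (F * A * E * X)
             ≈⟨ *-congʳ (sym X′-def) ⟩
           r * X * X′ * (F * A * E * X)
             ≈⟨ solve 6 (λ r A E F X X′ → r :* X :* X′ :* (F :* A :* E :* X)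
                  := r :* (F :* X′) :* (A :* X :* (E :* X)))
                refl r A E F X X′ ⟩
           r * (F * X′) * (A * X * (E * X))
             ∎) ⟩
    (r * (F * X′)) / (A * E)
      ≈⟨ sym (x*[y/z]≈[x*y]/z r (F * X′) (A * E)) ⟩
    e ∎)

  d*e≈b*c : ¬ (A ≈ 0#) → ¬ (B ≈ 0#) → ¬ (D ≈ 0#) → ¬ (E ≈ 0#) →
            ¬ (X ≈ 0#) → ¬ (X′ ≈ 0#) → d * e ≈ b * c
  d*e≈b*c A≉0 B≉0 D≉0 E≉0 X≉0 X′≉0 = begin
    d * e
      ≈⟨ scaled-/-*-/ (x*y≉0 B≉0 X′≉0) (x*y≉0 A≉0 E≉0) q (A * C) r (F * X′) ⟩
    (q * (A * C) * (r * (F * X′))) / (B * X′ * (A * E))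
      ≈⟨ /-cross (x*y≉0 (x*y≉0 B≉0 X′≉0) (x*y≉0 A≉0 E≉0)) (x*y≉0 (x*y≉0 B≉0 D≉0) (x*y≉0 E≉0 X≉0))
           (solve 10 (λ q r A B C D E F X X′ →
              q :* (A :* C) :* (r :* (F :* X′)) :* (B :* D :* (E :* X))
              := r :* (C :* X) :* (q :* (D :* F)) :* (B :* X′ :* (A :* E)))
            refl q r A B C D E F X X′) ⟩
    (r * (C * X) * (q * (D * F))) / (B * D * (E * X))
      ≈⟨ sym (scaled-/-*-/ (x*y≉0 B≉0 D≉0) (x*y≉0 E≉0 X≉0) r (C * X) q (D * F)) ⟩
    b * c ∎

  f*e≈a*b : ¬ (A ≈ 0#) → ¬ (B ≈ 0#) → ¬ (D ≈ 0#) → ¬ (E ≈ 0#) →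
            ¬ (X ≈ 0#) → ¬ (X′ ≈ 0#) → f * e ≈ a * b
  f*e≈a*b A≉0 B≉0 D≉0 E≉0 X≉0 X′≉0 = begin
    f * e
      ≈⟨ scaled-/-*-/ (x*y≉0 D≉0 X′≉0) (x*y≉0 A≉0 E≉0) p (C * E) r (F * X′) ⟩
    (p * (C * E) * (r * (F * X′))) / (D * X′ * (A * E))
      ≈⟨ /-cross (x*y≉0 (x*y≉0 D≉0 X′≉0) (x*y≉0 A≉0 E≉0)) (x*y≉0 (x*y≉0 A≉0 X≉0) (x*y≉0 B≉0 D≉0))
           (solve 10 (λ p r A B C D E F X X′ →
              p :* (C :* E) :* (r :* (F :* X′)) :* (A :* X :* (B :* D))
              := p :* (B :* F) :* (r :* (C :* X)) :* (D :* X′ :* (A :* E)))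
            refl p r A B C D E F X X′) ⟩
    (p * (B * F) * (r * (C * X))) / (A * X * (B * D))
      ≈⟨ sym (scaled-/-*-/ (x*y≉0 A≉0 X≉0) (x*y≉0 B≉0 D≉0) p (B * F) r (C * X)) ⟩
    a * b ∎

lemma3p1 : ∀ {c ℓ} (K : Field c ℓ) → let open Field K in
    (α β γ A B C D E F X X′ : Carrier) →
    ¬ (γ ≈ α) →
    ¬ (A ≈ 0#) → ¬ (B ≈ 0#) → ¬ (C ≈ 0#) → ¬ (D ≈ 0#) →
    ¬ (E ≈ 0#) → ¬ (F ≈ 0#) → ¬ (X ≈ 0#) →
    ¬ ((β − α) * B * E + (γ − β) * A * D ≈ 0#) →
    (γ − α) * X * X′ ≈ (β − α) * B * E + (γ − β) * A * D →
    let a = (β − α) * ((B * F) / (A * X))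
        b = (γ − α) * ((C * X) / (B * D))
        c = (γ − β) * ((D * F) / (E * X))
        d = (γ − β) * ((A * C) / (B * X′))
        e = (γ − α) * ((F * X′) / (A * E))
        f = (β − α) * ((C * E) / (D * X′))
    in ¬ (a + c ≈ 0#)
       × (d ≈ (b * c) / (a + c))
       × (e ≈ a + c)
       × (f ≈ (a * b) / (a + c))
lemma3p1 K α β γ A B C D E F X X′ γ≉α A≉0 B≉0 _ D≉0 E≉0 F≉0 X≉0 S≉0 X′-def =
  a+c≉0 , divide-by-e (d*e≈b*c A≉0 B≉0 D≉0 E≉0 X≉0 X′≉0) , e≈a+c′ ,
  divide-by-e (f*e≈a*b A≉0 B≉0 D≉0 E≉0 X≉0 X′≉0)
  where
  open Field K
  open FieldProperties K
  open BraidMove K (β − α) (γ − β) (γ − α) A B C D E F X X′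

  X′≉0 : ¬ (X′ ≈ 0#)
  X′≉0 X′≈0 = S≉0 (trans (sym X′-def) (trans (*-congˡ X′≈0) (zeroʳ ((γ − α) * X))))

  e≉0 : ¬ (e ≈ 0#)
  e≉0 = x*y≉0 (x−y≉0 γ≉α) (x/y≉0 (x*y≉0 F≉0 X′≉0) (x*y≉0 A≉0 E≉0))

  e≈a+c′ : e ≈ a + c
  e≈a+c′ = e≈a+c A≉0 E≉0 X≉0 X′-def

  a+c≉0 : ¬ (a + c ≈ 0#)
  a+c≉0 a+c≈0 = e≉0 (trans e≈a+c′ a+c≈0)

  divide-by-e : ∀ {x y} → x * e ≈ y → x ≈ y / (a + c)
  divide-by-e xe≈y = trans (*-≈⇒≈-/ e≉0 xe≈y) (*-congˡ (⁻¹-cong e≈a+c′))
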